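{- For every $n\ge1$ and every permutation $\pi\in\mathfrak S_n$, $\phi(\pi)=\varepsilon(h(w(\pi)))$, where $w(\pi)=\pi_n\pi_{n-1}\cdots\pi_1$ is the reversal of $\pi$.
   Context: $\mathfrak S_n$ is the symmetric group on $[n]$, in one-line notation; $\mathfrak S_0=\{\emptyset\}$. For $n\ge1$, $Y_n$ is the set of planar binary trees with $n$ internal nodes ($n+1$ leaves ordered left to right); $Y_0=\{\ast\}$, the trivial one-vertex tree. Let $t\in Y_1$ be the 2-corolla; for $T\in Y_p$ and $1\le i\le p+1$, $T\triangleleft_i t$ is the tree obtained by grafting $t$ onto the $i$-th leaf of $T$. For a word $a$ of distinct integers, $\mathrm{std}(a)$ is its standardization (replace the smallest letter by 1, the next by 2, etc.). Tonks' vertex map $\phi:\mathfrak S_n\to Y_n$ (restriction to vertices of Tonks' projection from the permutohedron to the associahedron; compositions in $x_1\cdots x_{n+1}$ are performed at positions $\pi_1,\dots,\pi_n$ in order) is given by $\phi(\emptyset)=\ast$, $\phi(1)=t$, and $\phi(\pi)=\phi(\mathrm{std}(\pi_2\cdots\pi_n))\triangleleft_{\pi_1}t$ for $n>1$. Indexed terms: the set $\mathcal L^I$ of terms is generated by symbols $\mathbf 2^k$ ($k$ a positive integer) of arity $|\mathbf 2^k|=2$, and, for terms $\mathbf A,\mathbf B$ and $1\le m\le|\mathbf A|$, the term $\mathbf A\circ_m\mathbf B$ of arity $|\mathbf A|+|\mathbf B|-1$; no index may occur more than once in a term. The evaluation $\varepsilon:\mathcal L^I\to\bigcup_n Y_n$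 forgets indices, sends each $\mathbf 2^k$ to the 2-corolla and $\mathbf A\circ_m\mathbf B$ to the tree obtained by grafting the root of $\varepsilon(\mathbf B)$ onto the $m$-th leaf of $\varepsilon(\mathbf A)$. Head-insertion encoding: for a word $a=a_1\cdots a_n$ of distinct positive integers, $h(a_1)=\mathbf 2^{a_1}$ and for $n>1$, $h(a)=h(a_1\cdots a_{n-1})\circ_r\mathbf 2^{a_n}$ with $r=1+|\{j<n: a_j<a_n\}|$. -}

module Defs where

open import Data.Nat using (ℕ; zero; suc; _+_; _∸_; _<?_; _≤?_)
open import Data.List using (List; []; _∷_; _++_; [_]; length; map; upTo; filter)
open import Data.List.Relation.Binary.Permutation.Propositional using (_↭_)
open import Data.Maybe using (Maybe; just; nothing)
open import Relation.Nullary using (yes; no)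

-- Planar binary trees; `leaf` is the trivial one-vertex tree ∗ (Y₀),
-- `node l r` an internal node with left/right subtrees.
-- A tree with n internal nodes has n+1 leaves (ordered left to right).
data Tree : Set where
  leaf : Tree
  node : Tree → Tree → Tree

-- number of internal nodes (T ∈ Y_n iff internal T = n)
internal : Tree → ℕ
internal leaf = 0
internal (node l r) = suc (internal l + internal r)

leaves : Tree → ℕ
leaves leaf = 1
leaves (node l r) = leaves l + leaves r

corolla : Tree
corolla = node leaf leaf

-- graft T i S : graft the root of S onto the i-th leaf (1-indexed) of T.
-- (Out-of-range indices leave T unchanged; they never occur below.)
graft : Tree → ℕ → Tree → Tree
graft leaf (suc zero) S = S
graft leaf _ S = leaf
graft (node l r) i S with i ≤? leaves l
... | yes _ = node (graft l i S) r
... | no _  = node l (graft r (i ∸ leaves l) S)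

-- Permutations of [n] in one-line notation: lists that are rearrangements of 1,2,…,n.
IsPerm : ℕ → List ℕ → Set
IsPerm n π = π ↭ map suc (upTo n)

countLess : ℕ → List ℕ → ℕ
countLess x a = length (filter (_<? x) a)

std : List ℕ → List ℕ
std a = map (λ x → suc (countLess x a)) a

-- Tonks' vertex map, by recursion on the length (fuel = length; std preserves length)
φ-fuel : ℕ → List ℕ → Tree
φ-fuel zero _ = leaf
φ-fuel (suc k) [] = leaf
φ-fuel (suc k) (x ∷ rest) = graft (φ-fuel k (std rest)) x corolla

φ : List ℕ → Tree
φ π = φ-fuel (length π) π

-- Indexed terms: generators 𝟐^k and partial compositions A ∘[ m ] B
data Term : Set where
  𝟐 : ℕ → Term
  _∘[_]_ : Term → ℕ → Term → Term

arity : Term → ℕ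
arity (𝟐 _) = 2
arity (A ∘[ m ] B) = arity A + arity B ∸ 1

ε : Term → Tree
ε (𝟐 _) = corolla
ε (A ∘[ m ] B) = graft (ε A) m (ε B)

-- head-insertion encoding, processing the word left to right:
-- h(a₁…aₙ) = h(a₁…aₙ₋₁) ∘_r 𝟐^{aₙ},  r = 1 + #{j < n : a_j < aₙ}
h-go : Term → List ℕ → List ℕ → Term
h-go T seen [] = T
h-go T seen (x ∷ xs) = h-go (T ∘[ suc (countLess x seen) ] 𝟐 x) (seen ++ [ x ]) xs

h : List ℕ → Maybe Term
h [] = nothing
h (a ∷ as) = just (h-go (𝟐 a) [ a ] as)

{-# OPTIONS --safe #-}
-- Both sides equal the tree obtained from the tree of the tail π₂⋯πₙ by grafting a
-- corolla onto its leaf 1 + #{j > 1 : πⱼ < π₁}.  For φ this holds for std π, for any word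
-- π, because standardization is invariant under order embeddings (here y ↦ rank of y in π)
-- and a permutation is its own standardization.  For ε ∘ h ∘ reverse it holds because the
-- last head insertion into the reversed word is exactly this grafting of π₁.
module Submission where

open import Defs
open import Data.Nat using (ℕ; zero; suc; _≥_; _≤_; _<_; _≮_; _<?_; z≤n; s≤s; s<s; s<s⁻¹)
open import Data.Nat.Properties using (<-≤-trans; <⇒≤; n≮n; n<1+n; ≮⇒≥; module ≤-Reasoning)
open import Data.List using (List; []; _∷_; _++_; _∷ʳ_; [_]; length; map; reverse; upTo)
open import Data.List.Properties using (filter-accept; filter-reject; map-∘; map-cong-local; map-id-local; map-upTo; unfold-reverse; ++-identityʳ; ++-assoc)
open import Data.List.Membership.Propositional using (_∈_)
open import Data.List.Membership.Propositional.Properties using (∈-∃++; ∈-map⁻; ∈-upTo⁻)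
open import Data.List.Relation.Unary.All using (All; []; _∷_; tabulate; universal)
open import Data.List.Relation.Unary.Any using (there)
open import Data.List.Relation.Binary.Permutation.Propositional using (_↭_)
open import Data.List.Relation.Binary.Permutation.Propositional.Properties using (filter-↭; ↭-length; ↭-reverse; ∈-resp-↭; shift)
open import Data.List.Relation.Binary.Sublist.Propositional using (⊆-refl)
open import Data.List.Relation.Binary.Sublist.Propositional.Properties using (filter⁺; length-mono-≤)
open import Data.Maybe using (fromMaybe; just)
open import Data.Product using (_,_)
open import Function using (_∘_; _⇔_; mk⇔; Equivalence)
open import Relation.Nullary using (yes; no; contradiction)
open import Relation.Binary.PropositionalEquality using (_≡_; refl; sym; trans; cong; cong₂; module ≡-Reasoning)

open Equivalence using (to; from)

countLess-accept : ∀ {x y} ys → y < x → countLess x (y ∷ ys) ≡ suc (countLess x ys)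
countLess-accept {x} ys y<x = cong length (filter-accept (_<? x) y<x)

countLess-reject : ∀ {x y} ys → y ≮ x → countLess x (y ∷ ys) ≡ countLess x ys
countLess-reject {x} ys y≮x = cong length (filter-reject (_<? x) y≮x)

countLess-↭ : ∀ x {l m} → l ↭ m → countLess x l ≡ countLess x m
countLess-↭ x l↭m = ↭-length (filter-↭ (_<? x) l↭m)

countLess-monoˡ-≤ : ∀ {a b} → a ≤ b → ∀ l → countLess a l ≤ countLess b l
countLess-monoˡ-≤ a≤b l =
  length-mono-≤ (filter⁺ (_<? _) (_<? _) (λ { refl y<a → <-≤-trans y<a a≤b }) (⊆-refl {x = l}))

countLess-monoˡ-< : ∀ {a b l} → a < b → a ∈ l → countLess a l < countLess b l
countLess-monoˡ-< {a} {b} a<b a∈l with ys , zs , refl ← ∈-∃++ a∈l = begin-strict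
  countLess a (ys ++ [ a ] ++ zs)  ≡⟨ countLess-↭ a (shift a ys zs) ⟩
  countLess a (a ∷ ys ++ zs)       ≡⟨ countLess-reject (ys ++ zs) (n≮n a) ⟩
  countLess a (ys ++ zs)           ≤⟨ countLess-monoˡ-≤ (<⇒≤ a<b) (ys ++ zs) ⟩
  countLess b (ys ++ zs)           <⟨ n<1+n _ ⟩
  suc (countLess b (ys ++ zs))     ≡⟨ countLess-accept (ys ++ zs) a<b ⟨
  countLess b (a ∷ ys ++ zs)       ≡⟨ countLess-↭ b (shift a ys zs) ⟨
  countLess b (ys ++ [ a ] ++ zs)  ∎
  where open ≤-Reasoning

countLess-map : ∀ {f : ℕ → ℕ} {y zs} → All (λ z → z < y ⇔ f z < f y) zs →
                countLess (f y) (map f zs) ≡ countLess y zs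
countLess-map [] = refl
countLess-map {f} {y} {z ∷ zs} (z<y⇔ ∷ es) with z <? y
... | yes z<y = begin
  countLess (f y) (f z ∷ map f zs)  ≡⟨ countLess-accept (map f zs) (to z<y⇔ z<y) ⟩
  suc (countLess (f y) (map f zs))  ≡⟨ cong suc (countLess-map es) ⟩
  suc (countLess y zs)              ≡⟨ countLess-accept zs z<y ⟨
  countLess y (z ∷ zs)              ∎
  where open ≡-Reasoning
... | no z≮y = begin
  countLess (f y) (f z ∷ map f zs)  ≡⟨ countLess-reject (map f zs) (z≮y ∘ from z<y⇔) ⟩
  countLess (f y) (map f zs)        ≡⟨ countLess-map es ⟩
  countLess y zs                    ≡⟨ countLess-reject zs z≮y ⟨
  countLess y (z ∷ zs)              ∎
  where open ≡-Reasoning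

countLess-map-suc : ∀ y l → countLess (suc y) (map suc l) ≡ countLess y l
countLess-map-suc y l = countLess-map (universal (λ _ → mk⇔ s<s s<s⁻¹) l)

countLess-zero : ∀ l → countLess 0 l ≡ 0
countLess-zero [] = refl
countLess-zero (z ∷ zs) = trans (countLess-reject {0} {z} zs λ ()) (countLess-zero zs)

countLess-upTo : ∀ {i n} → i ≤ n → countLess i (upTo n) ≡ i
countLess-upTo {zero} {n} _ = countLess-zero (upTo n)
countLess-upTo {suc i} {suc n} (s≤s i≤n) = begin
  countLess (suc i) (upTo (suc n))           ≡⟨ cong (countLess (suc i) ∘ (0 ∷_)) (map-upTo suc n) ⟨
  countLess (suc i) (0 ∷ map suc (upTo n))   ≡⟨ countLess-accept (map suc (upTo n)) (s≤s z≤n) ⟩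
  suc (countLess (suc i) (map suc (upTo n))) ≡⟨ cong suc (countLess-map-suc i (upTo n)) ⟩
  suc (countLess i (upTo n))                 ≡⟨ cong suc (countLess-upTo i≤n) ⟩
  suc i                                      ∎
  where open ≡-Reasoning

rank : List ℕ → ℕ → ℕ
rank l y = suc (countLess y l)

<⇔rank-< : ∀ {l a b} → a ∈ l → a < b ⇔ rank l a < rank l b
<⇔rank-< {l} {a} {b} a∈l = mk⇔ (λ a<b → s<s (countLess-monoˡ-< a<b a∈l)) rank-<⇒<
  where
  rank-<⇒< : rank l a < rank l b → a < b
  rank-<⇒< ra<rb with a <? b
  ... | yes a<b = a<b
  ... | no a≮b = contradiction (<-≤-trans ra<rb (s≤s (countLess-monoˡ-≤ (≮⇒≥ a≮b) l))) (n≮n _)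

std-map : ∀ {f : ℕ → ℕ} zs → (∀ {a b} → a ∈ zs → b ∈ zs → a < b ⇔ f a < f b) →
          std (map f zs) ≡ std zs
std-map {f} zs f-embedding = begin
  map (rank (map f zs)) (map f zs)  ≡⟨ map-∘ zs ⟨
  map (rank (map f zs) ∘ f) zs      ≡⟨ map-cong-local (tabulate rank-f) ⟩
  map (rank zs) zs                  ∎
  where
  open ≡-Reasoning
  rank-f : ∀ {y} → y ∈ zs → rank (map f zs) (f y) ≡ rank zs y
  rank-f y∈zs = cong suc (countLess-map (tabulate (λ z∈zs → f-embedding z∈zs y∈zs)))

std-IsPerm : ∀ {n π} → IsPerm n π → std π ≡ π
std-IsPerm {n} {π} π↭ = map-id-local (tabulate rank-π)
  where
  rank-π : ∀ {y} → y ∈ π → rank π y ≡ y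
  rank-π y∈π with i , i∈upTo , refl ← ∈-map⁻ suc (∈-resp-↭ π↭ y∈π) = cong suc (begin
    countLess (suc i) π                    ≡⟨ countLess-↭ (suc i) π↭ ⟩
    countLess (suc i) (map suc (upTo n))   ≡⟨ countLess-map-suc i (upTo n) ⟩
    countLess i (upTo n)                   ≡⟨ countLess-upTo (<⇒≤ (∈-upTo⁻ i∈upTo)) ⟩
    i                                      ∎)
    where open ≡-Reasoning

rankTree : List ℕ → Tree
rankTree [] = leaf
rankTree (x ∷ rest) = graft (rankTree rest) (suc (countLess x rest)) corolla

φ-fuel-std : ∀ l → φ-fuel (length l) (std l) ≡ rankTree l
φ-fuel-std [] = refl
φ-fuel-std (x ∷ rest) = cong₂ (λ T i → graft T i corolla) tail-tree head-rank
  where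
  open ≡-Reasoning
  tail-tree : φ-fuel (length rest) (std (map (rank (x ∷ rest)) rest)) ≡ rankTree rest
  tail-tree = begin
    φ-fuel (length rest) (std (map (rank (x ∷ rest)) rest))
      ≡⟨ cong (φ-fuel (length rest)) (std-map rest (λ a∈ _ → <⇔rank-< (there a∈))) ⟩
    φ-fuel (length rest) (std rest)
      ≡⟨ φ-fuel-std rest ⟩
    rankTree rest ∎
  head-rank : rank (x ∷ rest) x ≡ suc (countLess x rest)
  head-rank = cong suc (countLess-reject rest (n≮n x))

h-go-∷ʳ : ∀ T seen xs x →
          h-go T seen (xs ∷ʳ x) ≡ h-go T seen xs ∘[ suc (countLess x (seen ++ xs)) ] 𝟐 x
h-go-∷ʳ T seen [] x =
  cong (λ s → T ∘[ suc (countLess x s) ] 𝟐 x) (sym (++-identityʳ seen))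
h-go-∷ʳ T seen (y ∷ xs) x = trans
  (h-go-∷ʳ T′ (seen ++ [ y ]) xs x)
  (cong (λ s → h-go T′ (seen ++ [ y ]) xs ∘[ suc (countLess x s) ] 𝟐 x) (++-assoc seen [ y ] xs))
  where T′ = T ∘[ suc (countLess y seen) ] 𝟐 y

-- The trivial tree as value on the empty word makes `map-ε-h-∷ʳ` hold also for `l = []`.
εh : List ℕ → Tree
εh l = fromMaybe leaf (Data.Maybe.map ε (h l))

map-ε-h-∷ʳ : ∀ l x →
             Data.Maybe.map ε (h (l ∷ʳ x)) ≡ just (graft (εh l) (suc (countLess x l)) corolla)
map-ε-h-∷ʳ [] x = refl
map-ε-h-∷ʳ (a ∷ as) x = cong (just ∘ ε) (h-go-∷ʳ (𝟐 a) [ a ] as x)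

map-ε-h-reverse-∷ : ∀ x rest → Data.Maybe.map ε (h (reverse (x ∷ rest))) ≡ just (rankTree (x ∷ rest))
map-ε-h-reverse-∷ x rest = begin
  Data.Maybe.map ε (h (reverse (x ∷ rest)))
    ≡⟨ cong (Data.Maybe.map ε ∘ h) (unfold-reverse x rest) ⟩
  Data.Maybe.map ε (h (reverse rest ∷ʳ x))
    ≡⟨ map-ε-h-∷ʳ (reverse rest) x ⟩
  just (graft (εh (reverse rest)) (suc (countLess x (reverse rest))) corolla)
    ≡⟨ cong₂ (λ T c → just (graft T (suc c) corolla)) (εh-reverse rest) (countLess-↭ x (↭-reverse rest)) ⟩
  just (rankTree (x ∷ rest)) ∎
  where
  open ≡-Reasoning
  εh-reverse : ∀ l → εh (reverse l) ≡ rankTree l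
  εh-reverse [] = refl
  εh-reverse (y ∷ l) = cong (fromMaybe leaf) (map-ε-h-reverse-∷ y l)

corollary4p11 : (n : ℕ) → n ≥ 1 → (π : List ℕ) → IsPerm n π →
    Data.Maybe.map ε (h (reverse π)) ≡ just (φ π)
corollary4p11 zero () _ _
corollary4p11 (suc n) _ [] π↭ with () ← ↭-length π↭
corollary4p11 (suc n) _ π@(x ∷ rest) π↭ = begin
  Data.Maybe.map ε (h (reverse π))    ≡⟨ map-ε-h-reverse-∷ x rest ⟩
  just (rankTree π)                   ≡⟨ cong just (φ-fuel-std π) ⟨
  just (φ-fuel (length π) (std π))    ≡⟨ cong (just ∘ φ-fuel (length π)) (std-IsPerm π↭) ⟩
  just (φ π)                          ∎
  where open ≡-Reasoning
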